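{- Let $n\geq1$ and let $(X,*),(Y,\star)$ be finite free pointed $\bm{\mu}_{n}$-sets. For every $f\in\mathrm{Aut}(X)$ one has $\Delta_{X\times Y}(f\times \mathrm{Id})=\Delta_{X}(f)$.
   Context: $\bm{\mu}_n$ is a cyclic group of order $n$ (the $n$-th roots of unity). A finite free pointed $\bm{\mu}_n$-set is a finite pointed set $(X,*)$ with a $\bm{\mu}_n$-action fixing $*$ and free on $X\smallsetminus\{*\}$; $\mathrm{Aut}(X)$ is the group of $\bm{\mu}_n$-equivariant bijections fixing $*$. $X\times Y$ carries the diagonal action and marked point $(*,\star)$. For $f\in\mathrm{Aut}(X)$, choose representatives $x_1,\dots,x_t$ of the $\bm{\mu}_n$-orbits in $X\smallsetminus\{*\}$ and write $f(x_i)=\mu_f(i)x_{\sigma_f(i)}$ with $\mu_f(i)\in\bm{\mu}_n$ and $\sigma_f$ a permutation; then $\Delta_X(f)=\prod_{i=1}^t\mu_f(i)\in\bm{\mu}_n$ (this does not depend on the choice of representatives). -}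

module Defs where

open import Data.Nat using (ℕ; zero; suc; _+_)
open import Data.Nat.DivMod using (_mod_)
open import Data.Fin using (Fin; toℕ)
open import Data.Product using (Σ; _×_; _,_; proj₁; proj₂)
open import Data.Sum using (_⊎_; inj₁; inj₂)
open import Relation.Nullary using (¬_)
open import Relation.Binary.PropositionalEquality
  using (_≡_; refl; sym; trans; cong; cong₂)
open import Function.Bundles using (_↔_)

-- μ_n with n = suc k, written additively as ℤ/n = Fin (suc k).
-- (A primitive n-th root of unity ζ corresponds to 1; ζ^a ↔ a.)
μ : ℕ → Set
μ k = Fin (suc k)

_⊕_ : {k : ℕ} → μ k → μ k → μ k
_⊕_ {k} a b = (toℕ a + toℕ b) mod suc k

e : {k : ℕ} → μ k
e = Data.Fin.zero

prodμ : {k : ℕ} (t : ℕ) → (Fin t → μ k) → μ k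
prodμ zero    f = e
prodμ (suc t) f = f Data.Fin.zero ⊕ prodμ t (λ i → f (Data.Fin.suc i))

record FreePointedSet (k : ℕ) : Set₁ where
  field
    Carrier : Set
    pt      : Carrier
    act     : μ k → Carrier → Carrier
    act-e   : ∀ x → act e x ≡ x
    act-⊕   : ∀ g h x → act (g ⊕ h) x ≡ act g (act h x)
    act-pt  : ∀ g → act g pt ≡ pt
    free    : ∀ g x → act g x ≡ x → g ≡ e ⊎ x ≡ pt

open FreePointedSet public

IsFinite : {k : ℕ} → FreePointedSet k → Set
IsFinite X = Σ ℕ λ m → Carrier X ↔ Fin m

_⊗_ : {k : ℕ} → FreePointedSet k → FreePointedSet k → FreePointedSet k
X ⊗ Y = record
  { Carrier = Carrier X × Carrier Y
  ; pt      = pt X , pt Y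
  ; act     = λ g p → act X g (proj₁ p) , act Y g (proj₂ p)
  ; act-e   = λ p → cong₂ _,_ (act-e X (proj₁ p)) (act-e Y (proj₂ p))
  ; act-⊕   = λ g h p → cong₂ _,_ (act-⊕ X g h (proj₁ p)) (act-⊕ Y g h (proj₂ p))
  ; act-pt  = λ g → cong₂ _,_ (act-pt X g) (act-pt Y g)
  ; free    = fr
  }
  where
  fr : ∀ g p → (act X g (proj₁ p) , act Y g (proj₂ p)) ≡ p → g ≡ e ⊎ p ≡ (pt X , pt Y)
  fr g (x , y) eq with free X g x (cong proj₁ eq) | free Y g y (cong proj₂ eq)
  ... | inj₁ g≡e | _        = inj₁ g≡e
  ... | inj₂ _   | inj₁ g≡e = inj₁ g≡e
  ... | inj₂ px  | inj₂ py  = inj₂ (cong₂ _,_ px py)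

record Aut {k : ℕ} (X : FreePointedSet k) : Set where
  field
    fun   : Carrier X → Carrier X
    inv   : Carrier X → Carrier X
    inv-l : ∀ x → inv (fun x) ≡ x
    inv-r : ∀ x → fun (inv x) ≡ x
    equiv : ∀ g x → fun (act X g x) ≡ act X g (fun x)
    fix   : fun (pt X) ≡ pt X

open Aut public

_×Id : {k : ℕ} {X : FreePointedSet k} → Aut X → {Y : FreePointedSet k} → Aut (X ⊗ Y)
_×Id {X = X} f {Y} = record
  { fun   = λ p → fun f (proj₁ p) , proj₂ p
  ; inv   = λ p → inv f (proj₁ p) , proj₂ p
  ; inv-l = λ p → cong (_, proj₂ p) (inv-l f (proj₁ p))
  ; inv-r = λ p → cong (_, proj₂ p) (inv-r f (proj₁ p))
  ; equiv = λ g p → cong (_, act Y g (proj₂ p)) (equiv f g (proj₁ p))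
  ; fix   = cong (_, pt Y) (fix f)
  }

record Reps {k : ℕ} (X : FreePointedSet k) : Set where
  field
    t        : ℕ
    rep      : Fin t → Carrier X
    rep-pt   : ∀ i → ¬ (rep i ≡ pt X)
    distinct : ∀ g i j → act X g (rep i) ≡ rep j → i ≡ j
    decomp   : (x : Carrier X) → ¬ (x ≡ pt X) →
               Σ (μ k) λ g → Σ (Fin t) λ j → x ≡ act X g (rep j)

open Reps public

aut-ne : {k : ℕ} {X : FreePointedSet k} (f : Aut X) (x : Carrier X) →
         ¬ (x ≡ pt X) → ¬ (fun f x ≡ pt X)
aut-ne {X = X} f x x≢pt fx≡pt =
  x≢pt (trans (sym (inv-l f x))
        (trans (cong (inv f) fx≡pt)
        (trans (cong (inv f) (sym (fix f))) (inv-l f (pt X)))))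

-- μ_f(i): f(x_i) = μ_f(i) · x_{σ_f(i)}
μf : {k : ℕ} {X : FreePointedSet k} (R : Reps X) (f : Aut X) → Fin (t R) → μ k
μf R f i = proj₁ (decomp R (fun f (rep R i)) (aut-ne f (rep R i) (rep-pt R i)))

Δ : {k : ℕ} {X : FreePointedSet k} → Reps X → Aut X → μ k
Δ R f = prodμ (t R) (μf R f)

-- Write F = f × Id. Every x ∈ X ∖ {*} is uniquely c(x) · x_i; put m(x) = μ_f(i). For
-- representatives r_j = (a_j , b_j) of X × Y, the relation F(r_j) = g_j · r_σ(j) forces
-- g_j · c(a_σ(j)) = c(a_j) · m(a_j), and since σ permutes the orbits the c-terms cancel in
-- the product: Δ_{X×Y}(F) = ∏_j m(a_j). Counting X × Y orbit by orbit over X (with the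
-- exponents in ℕ, where dividing by n is legitimate) gives ∏_j m(a_j) = Δ_X(f)^|Y|.
-- Finally |W| ≡ 1 (mod n) for every finite free pointed W; applied to X and X × Y this
-- yields |Y| ≡ 1 (mod n).

module Submission where

open import Defs
open import Level using (0ℓ)
open import Algebra.Bundles using (AbelianGroup)
import Algebra.Properties.Group as GroupProperties
open import Data.Empty using (⊥-elim)
open import Data.Fin using (Fin; toℕ; combine; remQuot; _↑ˡ_; _↑ʳ_)
import Data.Fin as F
open import Data.Fin.Permutation using (Permutation; permutation)
open import Data.Fin.Properties
  using (toℕ<n; toℕ-fromℕ<; fromℕ<-toℕ; fromℕ<-cong; remQuot-combine; combine-remQuot;
         inj⇒≟; *↔×)
open import Data.Maybe using (Maybe; just; nothing; maybe)
open import Data.Nat using (ℕ; zero; suc; _+_; _*_; _∸_; _%_)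
open import Data.Nat.Properties
  using (+-comm; +-assoc; +-identityʳ; *-zeroʳ; *-distribˡ-+; *-comm; *-assoc; *-identityʳ;
         *-identityˡ; *-cancelˡ-≡; m∸n+n≡m; <⇒≤; +-0-commutativeMonoid)
open import Data.Nat.DivMod
  using (_mod_; m%n<n; %-distribˡ-+; %-distribˡ-*; m<n⇒m%n≡m; n%n≡0; [m+kn]%n≡m%n)
open import Data.Product using (_×_; _,_; proj₁; proj₂)
open import Data.Product.Function.NonDependent.Propositional using (_×-↔_)
open import Data.Sum using (inj₁; inj₂)
open import Data.Vec.Functional using (Vector)
open import Function using (_∘_; const)
open import Function.Bundles using (_↔_; Inverse; mk↔ₛ′)
open import Function.Construct.Composition using (_↔-∘_)
open import Function.Construct.Symmetry using (↔-sym)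
open import Function.Properties.Inverse using (↔⇒↣)
open import Relation.Binary.Definitions using (DecidableEquality)
open import Relation.Binary.PropositionalEquality
open import Relation.Nullary using (¬_; Dec; yes; no)
open import Algebra.Properties.CommutativeMonoid.Sum +-0-commutativeMonoid
  using (sum; sum-cong-≗; sum-permute)
open ≡-Reasoning

module _ {k : ℕ} where

  private
    n : ℕ
    n = suc k

  mod-cong : ∀ x y → x % n ≡ y % n → x mod n ≡ y mod n
  mod-cong x y eq = fromℕ<-cong _ _ eq (m%n<n x n) (m%n<n y n)

  toℕ-mod : (a : μ k) → toℕ a mod n ≡ a
  toℕ-mod a = trans (fromℕ<-cong _ _ (m<n⇒m%n≡m (toℕ<n a)) (m%n<n (toℕ a) n) (toℕ<n a))
                    (fromℕ<-toℕ a (toℕ<n a))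

  mod-+-homo : ∀ x y → (x + y) mod n ≡ (x mod n) ⊕ (y mod n)
  mod-+-homo x y = mod-cong (x + y) (toℕ (x mod n) + toℕ (y mod n)) (begin
    (x + y) % n                          ≡⟨ %-distribˡ-+ x y n ⟩
    (x % n + y % n) % n                  ≡⟨ cong₂ (λ a b → (a + b) % n)
                                                  (toℕ-fromℕ< (m%n<n x n)) (toℕ-fromℕ< (m%n<n y n)) ⟨
    (toℕ (x mod n) + toℕ (y mod n)) % n  ∎)

  ⊕-comm : ∀ a b → a ⊕ b ≡ b ⊕ a
  ⊕-comm a b = cong (_mod n) (+-comm (toℕ a) (toℕ b))

  ⊕-assoc : ∀ a b c → (a ⊕ b) ⊕ c ≡ a ⊕ (b ⊕ c)
  ⊕-assoc a b c = begin
    (a ⊕ b) ⊕ c                      ≡⟨ cong ((a ⊕ b) ⊕_) (toℕ-mod c) ⟨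
    (a ⊕ b) ⊕ (toℕ c mod n)          ≡⟨ mod-+-homo (toℕ a + toℕ b) (toℕ c) ⟨
    (toℕ a + toℕ b + toℕ c) mod n    ≡⟨ cong (_mod n) (+-assoc (toℕ a) (toℕ b) (toℕ c)) ⟩
    (toℕ a + (toℕ b + toℕ c)) mod n  ≡⟨ mod-+-homo (toℕ a) (toℕ b + toℕ c) ⟩
    (toℕ a mod n) ⊕ (b ⊕ c)          ≡⟨ cong (_⊕ (b ⊕ c)) (toℕ-mod a) ⟩
    a ⊕ (b ⊕ c)                      ∎

  ⊕-identityʳ : ∀ a → a ⊕ e ≡ a
  ⊕-identityʳ a = trans (cong (_mod n) (+-identityʳ (toℕ a))) (toℕ-mod a)

  ⊖_ : μ k → μ k
  ⊖ a = (n ∸ toℕ a) mod n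

  ⊖-inverseˡ : ∀ a → (⊖ a) ⊕ a ≡ e
  ⊖-inverseˡ a = begin
    (⊖ a) ⊕ a                    ≡⟨ cong ((⊖ a) ⊕_) (toℕ-mod a) ⟨
    (⊖ a) ⊕ (toℕ a mod n)        ≡⟨ mod-+-homo (n ∸ toℕ a) (toℕ a) ⟨
    (n ∸ toℕ a + toℕ a) mod n    ≡⟨ cong (_mod n) (m∸n+n≡m (<⇒≤ (toℕ<n a))) ⟩
    n mod n                      ≡⟨ mod-cong n 0 (n%n≡0 n) ⟩
    e                            ∎

  ⊕-abelianGroup : AbelianGroup 0ℓ 0ℓ
  ⊕-abelianGroup = record
    { Carrier        = μ k
    ; _≈_            = _≡_
    ; _∙_            = _⊕_
    ; ε              = e
    ; _⁻¹            = ⊖_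
    ; isAbelianGroup = record
      { isGroup = record
        { isMonoid = record
          { isSemigroup = record
            { isMagma = record { isEquivalence = isEquivalence ; ∙-cong = cong₂ _⊕_ }
            ; assoc   = ⊕-assoc
            }
          ; identity = (λ a → trans (⊕-comm e a) (⊕-identityʳ a)) , ⊕-identityʳ
          }
        ; inverse = ⊖-inverseˡ , (λ a → trans (⊕-comm a (⊖ a)) (⊖-inverseˡ a))
        ; ⁻¹-cong = cong ⊖_
        }
      ; comm = ⊕-comm
      }
    }

  open GroupProperties (AbelianGroup.group ⊕-abelianGroup) public
    using () renaming (∙-cancelˡ to ⊕-cancelˡ; ∙-cancelʳ to ⊕-cancelʳ)
  open import Algebra.Properties.CommutativeMonoid.Sum (AbelianGroup.commutativeMonoid ⊕-abelianGroup)
    public using ()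
    renaming (sum to ∏; sum-cong-≗ to ∏-cong-≗; sum-permute to ∏-permute;
              ∑-distrib-+ to ∏-distrib-⊕)

  prodμ≡∏ : ∀ t (f : Vector (μ k) t) → prodμ t f ≡ ∏ f
  prodμ≡∏ zero    f = refl
  prodμ≡∏ (suc t) f = cong (f F.zero ⊕_) (prodμ≡∏ t (f ∘ F.suc))

  prodμ≡sum-mod : ∀ t (f : Vector (μ k) t) → prodμ t f ≡ sum (toℕ ∘ f) mod n
  prodμ≡sum-mod zero    f = refl
  prodμ≡sum-mod (suc t) f = begin
    f F.zero ⊕ prodμ t (f ∘ F.suc)
      ≡⟨ cong₂ _⊕_ (sym (toℕ-mod (f F.zero))) (prodμ≡sum-mod t (f ∘ F.suc)) ⟩
    (toℕ (f F.zero) mod n) ⊕ (sum (toℕ ∘ f ∘ F.suc) mod n)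
      ≡⟨ mod-+-homo (toℕ (f F.zero)) _ ⟨
    (toℕ (f F.zero) + sum (toℕ ∘ f ∘ F.suc)) mod n
      ∎

  m%n≡1%n⇒[m*o]%n≡o%n : ∀ a b → a % n ≡ 1 % n → (a * b) % n ≡ b % n
  m%n≡1%n⇒[m*o]%n≡o%n a b a≡1 = begin
    (a * b) % n                ≡⟨ %-distribˡ-* a b n ⟩
    ((a % n) * (b % n)) % n    ≡⟨ cong (λ x → (x * (b % n)) % n) a≡1 ⟩
    ((1 % n) * (b % n)) % n    ≡⟨ %-distribˡ-* 1 b n ⟨
    (1 * b) % n                ≡⟨ cong (_% n) (*-identityˡ b) ⟩
    b % n                      ∎

module _ {k : ℕ} (W : FreePointedSet k) where

  act-⊖-act : ∀ g w → act W (⊖ g) (act W g w) ≡ w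
  act-⊖-act g w = begin
    act W (⊖ g) (act W g w)  ≡⟨ act-⊕ W (⊖ g) g w ⟨
    act W ((⊖ g) ⊕ g) w      ≡⟨ cong (λ h → act W h w) (⊖-inverseˡ g) ⟩
    act W e w                ≡⟨ act-e W w ⟩
    w                        ∎

  act≡pt⇒≡pt : ∀ g w → act W g w ≡ pt W → w ≡ pt W
  act≡pt⇒≡pt g w eq = trans (sym (act-⊖-act g w)) (trans (cong (act W (⊖ g)) eq) (act-pt W (⊖ g)))

  act-injectiveˡ : ∀ {w} g h → ¬ (w ≡ pt W) → act W g w ≡ act W h w → g ≡ h
  act-injectiveˡ {w} g h w≢pt eq with free W ((⊖ h) ⊕ g) w fixes
    where
    fixes : act W ((⊖ h) ⊕ g) w ≡ w
    fixes = trans (act-⊕ W (⊖ h) g w) (trans (cong (act W (⊖ h)) eq) (act-⊖-act h w))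
  ... | inj₁ ⊖h⊕g≡e = ⊕-cancelˡ (⊖ h) g h (trans ⊖h⊕g≡e (sym (⊖-inverseˡ h)))
  ... | inj₂ w≡pt   = ⊥-elim (w≢pt w≡pt)

  module _ (R : Reps W) where

    act-rep≢pt : ∀ g i → ¬ (act W g (rep R i) ≡ pt W)
    act-rep≢pt g i = rep-pt R i ∘ act≡pt⇒≡pt g (rep R i)

    act-rep-injective : ∀ {g h i j} → act W g (rep R i) ≡ act W h (rep R j) → (g , i) ≡ (h , j)
    act-rep-injective {g} {h} {i} {j} eq with distinct R ((⊖ h) ⊕ g) i j moved
      where
      moved : act W ((⊖ h) ⊕ g) (rep R i) ≡ rep R j
      moved = trans (act-⊕ W (⊖ h) g _) (trans (cong (act W (⊖ h)) eq) (act-⊖-act h _))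
    ... | refl = cong (_, i) (act-injectiveˡ g h (rep-pt R i) eq)

module _ {k : ℕ} {W : FreePointedSet k} where

  Aut⁻¹ : Aut W → Aut W
  Aut⁻¹ F = record
    { fun   = inv F
    ; inv   = fun F
    ; inv-l = inv-r F
    ; inv-r = inv-l F
    ; equiv = λ g w → begin
        inv F (act W g w)                   ≡⟨ cong (λ v → inv F (act W g v)) (inv-r F w) ⟨
        inv F (act W g (fun F (inv F w)))   ≡⟨ cong (inv F) (equiv F g (inv F w)) ⟨
        inv F (fun F (act W g (inv F w)))   ≡⟨ inv-l F _ ⟩
        act W g (inv F w)                   ∎
    ; fix   = trans (cong (inv F) (sym (fix F))) (inv-l F (pt W))
    }

  module _ (R : Reps W) where

    σ : Aut W → Fin (t R) → Fin (t R)
    σ F i = proj₁ (proj₂ (decomp R (fun F (rep R i)) (aut-ne F (rep R i) (rep-pt R i))))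

    fun-rep : ∀ F i → fun F (rep R i) ≡ act W (μf R F i) (rep R (σ F i))
    fun-rep F i = proj₂ (proj₂ (decomp R (fun F (rep R i)) (aut-ne F (rep R i) (rep-pt R i))))

    σ-inverse : ∀ F G → (∀ w → fun G (fun F w) ≡ w) → ∀ i → σ G (σ F i) ≡ i
    σ-inverse F G G∘F≡id i = distinct R (g ⊕ h) (σ G (σ F i)) i (sym (begin
      rep R i                                    ≡⟨ G∘F≡id (rep R i) ⟨
      fun G (fun F (rep R i))                    ≡⟨ cong (fun G) (fun-rep F i) ⟩
      fun G (act W g (rep R (σ F i)))            ≡⟨ equiv G g _ ⟩
      act W g (fun G (rep R (σ F i)))            ≡⟨ cong (act W g) (fun-rep G (σ F i)) ⟩
      act W g (act W h (rep R (σ G (σ F i))))    ≡⟨ act-⊕ W g h _ ⟨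
      act W (g ⊕ h) (rep R (σ G (σ F i)))        ∎))
      where
      g h : μ k
      g = μf R F i
      h = μf R G (σ F i)

    σ-permutation : Aut W → Permutation (t R) (t R)
    σ-permutation F = permutation (σ F) (σ (Aut⁻¹ F))
      (σ-inverse (Aut⁻¹ F) F (inv-r F)) (σ-inverse F (Aut⁻¹ F) (inv-l F))

    Δ-telescope : ∀ F (c m : Fin (t R) → μ k) →
                  (∀ i j g → fun F (rep R i) ≡ act W g (rep R j) → g ⊕ c j ≡ c i ⊕ m i) →
                  Δ R F ≡ prodμ (t R) m
    Δ-telescope F c m cocycle = begin
      prodμ (t R) (μf R F)   ≡⟨ prodμ≡∏ (t R) (μf R F) ⟩
      ∏ (μf R F)             ≡⟨ ⊕-cancelʳ (∏ c) (∏ (μf R F)) (∏ m) telescoped ⟩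
      ∏ m                    ≡⟨ prodμ≡∏ (t R) m ⟨
      prodμ (t R) m          ∎
      where
      telescoped : ∏ (μf R F) ⊕ ∏ c ≡ ∏ m ⊕ ∏ c
      telescoped = begin
        ∏ (μf R F) ⊕ ∏ c
          ≡⟨ cong (∏ (μf R F) ⊕_) (∏-permute c (σ-permutation F)) ⟩
        ∏ (μf R F) ⊕ ∏ (c ∘ σ F)
          ≡⟨ ∏-distrib-⊕ (μf R F) (c ∘ σ F) ⟨
        ∏ (λ i → μf R F i ⊕ c (σ F i))
          ≡⟨ ∏-cong-≗ (λ i → cocycle i (σ F i) (μf R F i) (fun-rep F i)) ⟩
        ∏ (λ i → c i ⊕ m i)
          ≡⟨ ∏-distrib-⊕ c m ⟩
        ∏ c ⊕ ∏ m
          ≡⟨ ⊕-comm (∏ c) (∏ m) ⟩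
        ∏ m ⊕ ∏ c
          ∎

sum-const : ∀ a c → sum {a} (const c) ≡ a * c
sum-const zero    c = refl
sum-const (suc a) c = cong (c +_) (sum-const a c)

sum-splitAt : ∀ a b (h : Fin (a + b) → ℕ) →
              sum h ≡ sum (λ i → h (i ↑ˡ b)) + sum (λ j → h (a ↑ʳ j))
sum-splitAt zero    b h = refl
sum-splitAt (suc a) b h = begin
  h F.zero + sum (h ∘ F.suc)
    ≡⟨ cong (h F.zero +_) (sum-splitAt a b (h ∘ F.suc)) ⟩
  h F.zero + (sum (λ i → h (F.suc i ↑ˡ b)) + sum (λ j → h (suc a ↑ʳ j)))
    ≡⟨ +-assoc (h F.zero) _ _ ⟨
  h F.zero + sum (λ i → h (F.suc i ↑ˡ b)) + sum (λ j → h (suc a ↑ʳ j))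
    ∎

sum-combine-const : ∀ a b (h : Fin (a * b) → ℕ) (ψ : Fin a → ℕ) →
                    (∀ i j → h (combine i j) ≡ ψ i) → sum h ≡ b * sum ψ
sum-combine-const zero    b h ψ h≡ψ = sym (*-zeroʳ b)
sum-combine-const (suc a) b h ψ h≡ψ = begin
  sum h                                                 ≡⟨ sum-splitAt b (a * b) h ⟩
  sum (λ j → h (j ↑ˡ (a * b))) + sum (h ∘ (b ↑ʳ_))     ≡⟨ cong₂ _+_ first-block other-blocks ⟩
  b * ψ F.zero + b * sum (ψ ∘ F.suc)                    ≡⟨ *-distribˡ-+ b (ψ F.zero) _ ⟨
  b * sum ψ                                             ∎
  where
  first-block : sum (λ j → h (j ↑ˡ (a * b))) ≡ b * ψ F.zero
  first-block = trans (sum-cong-≗ {b} (h≡ψ F.zero)) (sum-const b (ψ F.zero))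

  other-blocks : sum (h ∘ (b ↑ʳ_)) ≡ b * sum (ψ ∘ F.suc)
  other-blocks = sum-combine-const a b _ (ψ ∘ F.suc) (h≡ψ ∘ F.suc)

sumOver : {A : Set} {m : ℕ} → A ↔ Fin m → (A → ℕ) → ℕ
sumOver I φ = sum (φ ∘ Inverse.from I)

sumOver-enumeration : {A : Set} {a b : ℕ} (I : A ↔ Fin a) (J : A ↔ Fin b) (φ : A → ℕ) →
                      sumOver I φ ≡ sumOver J φ
sumOver-enumeration I J φ = begin
  sum (φ ∘ Inverse.from I)                                  ≡⟨ sum-permute _ (I ↔-∘ ↔-sym J) ⟩
  sum (φ ∘ Inverse.from I ∘ Inverse.to I ∘ Inverse.from J)
    ≡⟨ sum-cong-≗ (cong φ ∘ Inverse.strictlyInverseʳ I ∘ Inverse.from J) ⟩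
  sum (φ ∘ Inverse.from J)                                  ∎

_×-enumeration_ : {A B : Set} {a b : ℕ} → A ↔ Fin a → B ↔ Fin b → (A × B) ↔ Fin (a * b)
I ×-enumeration J = ↔-sym *↔× ↔-∘ (I ×-↔ J)

sumOver-proj₁ : {A B : Set} {a b : ℕ} (I : A ↔ Fin a) (J : B ↔ Fin b) (φ : A → ℕ) →
                sumOver (I ×-enumeration J) (φ ∘ proj₁) ≡ b * sumOver I φ
sumOver-proj₁ {a = a} {b} I J φ = sum-combine-const a b _ (φ ∘ Inverse.from I)
  (λ i j → cong (φ ∘ Inverse.from I ∘ proj₁) (remQuot-combine i j))

module Orbits {k : ℕ} {W : FreePointedSet k} (R : Reps W) {m : ℕ} (I : Carrier W ↔ Fin m) where

  private
    n : ℕ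
    n = suc k

  _≟_ : DecidableEquality (Carrier W)
  _≟_ = inj⇒≟ (↔⇒↣ I)

  data Located : Carrier W → Set where
    at-pt  : Located (pt W)
    at-rep : ∀ g i → Located (act W g (rep R i))

  locate : ∀ w → Located w
  locate w with w ≟ pt W
  ... | yes refl = at-pt
  ... | no w≢pt with decomp R w w≢pt
  ...   | g , i , refl = at-rep g i

  position : Carrier W → Maybe (μ k × Fin (t R))
  position w with w ≟ pt W
  ... | yes _    = nothing
  ... | no w≢pt  = just (proj₁ d , proj₁ (proj₂ d))
    where d = decomp R w w≢pt

  position-pt : position (pt W) ≡ nothing
  position-pt with pt W ≟ pt W
  ... | yes _     = refl
  ... | no pt≢pt  = ⊥-elim (pt≢pt refl)

  position-act-rep : ∀ g i → position (act W g (rep R i)) ≡ just (g , i)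
  position-act-rep g i with act W g (rep R i) ≟ pt W
  ... | yes eq  = ⊥-elim (act-rep≢pt W R g i eq)
  ... | no ne   = cong just (act-rep-injective W R (sym (proj₂ (proj₂ (decomp R _ ne)))))

  coordinate : Carrier W → μ k
  coordinate = maybe proj₁ e ∘ position

  coordinate-act-rep : ∀ g i → coordinate (act W g (rep R i)) ≡ g
  coordinate-act-rep g i = cong (maybe proj₁ e) (position-act-rep g i)

  extend : {A : Set} → A → (Fin (t R) → A) → Carrier W → A
  extend a h = maybe (h ∘ proj₂) a ∘ position

  module _ {A : Set} (a : A) (h : Fin (t R) → A) where

    extend-pt : extend a h (pt W) ≡ a
    extend-pt = cong (maybe (h ∘ proj₂) a) position-pt

    extend-act-rep : ∀ g i → extend a h (act W g (rep R i)) ≡ h i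
    extend-act-rep g i = cong (maybe (h ∘ proj₂) a) (position-act-rep g i)

    extend-rep : ∀ i → extend a h (rep R i) ≡ h i
    extend-rep i = trans (cong (extend a h) (sym (act-e W (rep R i)))) (extend-act-rep e i)

    extend-invariant : ∀ g w → extend a h (act W g w) ≡ extend a h w
    extend-invariant g w with locate w
    ... | at-pt       = cong (extend a h) (act-pt W g)
    ... | at-rep g′ i = begin
      extend a h (act W g (act W g′ (rep R i)))  ≡⟨ cong (extend a h) (act-⊕ W g g′ (rep R i)) ⟨
      extend a h (act W (g ⊕ g′) (rep R i))      ≡⟨ extend-act-rep (g ⊕ g′) i ⟩
      h i                                        ≡⟨ extend-act-rep g′ i ⟨
      extend a h (act W g′ (rep R i))            ∎

  orbitEnumeration : Carrier W ↔ Fin (suc (t R * n))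
  orbitEnumeration = mk↔ₛ′ to from to∘from from∘to
    where
    to : Carrier W → Fin (suc (t R * n))
    to = maybe (λ (g , i) → F.suc (combine i g)) F.zero ∘ position

    from : Fin (suc (t R * n)) → Carrier W
    from F.zero    = pt W
    from (F.suc j) = let (i , g) = remQuot n j in act W g (rep R i)

    to∘from : ∀ j → to (from j) ≡ j
    to∘from F.zero    = cong (maybe _ F.zero) position-pt
    to∘from (F.suc j) = trans (cong (maybe _ F.zero) (position-act-rep _ _))
                              (cong F.suc (combine-remQuot {t R} n j))

    from∘to : ∀ w → from (to w) ≡ w
    from∘to w with locate w
    ... | at-pt      = cong (from ∘ maybe _ F.zero) position-pt
    ... | at-rep g i = begin
      from (to (act W g (rep R i)))
        ≡⟨ cong (from ∘ maybe _ F.zero) (position-act-rep g i) ⟩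
      from (F.suc (combine i g))
        ≡⟨ cong (λ (i′ , g′) → act W g′ (rep R i′)) (remQuot-combine i g) ⟩
      act W g (rep R i)
        ∎

  orbit-sum : (φ : Carrier W → ℕ) → (∀ g w → φ (act W g w) ≡ φ w) →
              sumOver I φ ≡ φ (pt W) + n * sum (φ ∘ rep R)
  orbit-sum φ φ-invariant = begin
    sumOver I φ
      ≡⟨ sumOver-enumeration I orbitEnumeration φ ⟩
    sumOver orbitEnumeration φ
      ≡⟨ cong (φ (pt W) +_) (sum-combine-const (t R) n _ (φ ∘ rep R) φ-on-orbit) ⟩
    φ (pt W) + n * sum (φ ∘ rep R)
      ∎
    where
    φ-on-orbit : ∀ i g → φ (Inverse.from orbitEnumeration (F.suc (combine i g))) ≡ φ (rep R i)
    φ-on-orbit i g = trans (cong (λ (i′ , g′) → φ (act W g′ (rep R i′))) (remQuot-combine i g))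
                           (φ-invariant g (rep R i))

  card≡1-mod : m % n ≡ 1 % n
  card≡1-mod = begin
    m % n                              ≡⟨ cong (_% n) (trans (sum-const m 1) (*-identityʳ m)) ⟨
    sumOver I (const 1) % n            ≡⟨ cong (_% n) (orbit-sum (const 1) (λ _ _ → refl)) ⟩
    (1 + n * sum {t R} (const 1)) % n  ≡⟨ cong (λ x → (1 + x) % n) (*-comm n _) ⟩
    (1 + sum {t R} (const 1) * n) % n  ≡⟨ [m+kn]%n≡m%n 1 (sum {t R} (const 1)) n ⟩
    1 % n                              ∎

  multiplier : Aut W → Carrier W → μ k
  multiplier f = extend e (μf R f)

  coordinate-cocycle : ∀ f {x} g x′ → ¬ (x ≡ pt W) → fun f x ≡ act W g x′ →
                       g ⊕ coordinate x′ ≡ coordinate x ⊕ multiplier f x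
  coordinate-cocycle f {x} g x′ x≢pt fx≡gx′ with locate x | locate x′
  ... | at-pt      | _            = ⊥-elim (x≢pt refl)
  ... | at-rep h i | at-pt        = ⊥-elim (aut-ne f _ (act-rep≢pt W R h i) (trans fx≡gx′ (act-pt W g)))
  ... | at-rep h i | at-rep h′ i′ = begin
    g ⊕ coordinate (act W h′ (rep R i′))
      ≡⟨ cong (g ⊕_) (coordinate-act-rep h′ i′) ⟩
    g ⊕ h′
      ≡⟨ cong proj₁ (act-rep-injective W R same-point) ⟩
    h ⊕ μf R f i
      ≡⟨ cong₂ _⊕_ (coordinate-act-rep h i) (extend-act-rep e (μf R f) h i) ⟨
    coordinate (act W h (rep R i)) ⊕ multiplier f (act W h (rep R i))
      ∎
    where
    same-point : act W (g ⊕ h′) (rep R i′) ≡ act W (h ⊕ μf R f i) (rep R (σ R f i))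
    same-point = begin
      act W (g ⊕ h′) (rep R i′)                   ≡⟨ act-⊕ W g h′ _ ⟩
      act W g (act W h′ (rep R i′))               ≡⟨ fx≡gx′ ⟨
      fun f (act W h (rep R i))                   ≡⟨ equiv f h (rep R i) ⟩
      act W h (fun f (rep R i))                   ≡⟨ cong (act W h) (fun-rep R f i) ⟩
      act W h (act W (μf R f i) (rep R (σ R f i)))  ≡⟨ act-⊕ W h _ _ ⟨
      act W (h ⊕ μf R f i) (rep R (σ R f i))      ∎

module ProductOrbits {k : ℕ} {X Y : FreePointedSet k} (RX : Reps X) (RXY : Reps (X ⊗ Y))
                     {mX mY : ℕ} (IX : Carrier X ↔ Fin mX) (IY : Carrier Y ↔ Fin mY) where

  private
    n : ℕ
    n = suc k

  open Orbits RX IX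
  module Z = Orbits RXY (IX ×-enumeration IY)

  a : Fin (t RXY) → Carrier X
  a j = proj₁ (rep RXY j)

  ×Id-cocycle : ∀ f i j g → fun ((f ×Id) {Y}) (rep RXY i) ≡ act (X ⊗ Y) g (rep RXY j) →
                g ⊕ coordinate (a j) ≡ coordinate (a i) ⊕ multiplier f (a i)
  ×Id-cocycle f i j g eq = by-cases (a i ≟ pt X)
    where
    by-cases : Dec (a i ≡ pt X) → g ⊕ coordinate (a j) ≡ coordinate (a i) ⊕ multiplier f (a i)
    by-cases (no aᵢ≢pt)  = coordinate-cocycle f g (a j) aᵢ≢pt (cong proj₁ eq)
    by-cases (yes aᵢ≡pt) with act-rep-injective (X ⊗ Y) RXY (trans (sym fixed) eq)
      where
      fixed : fun ((f ×Id) {Y}) (rep RXY i) ≡ act (X ⊗ Y) e (rep RXY i)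
      fixed = trans (cong (_, proj₂ (rep RXY i)) f-fixes-aᵢ) (sym (act-e (X ⊗ Y) (rep RXY i)))
        where
        f-fixes-aᵢ : fun f (a i) ≡ a i
        f-fixes-aᵢ = trans (cong (fun f) aᵢ≡pt) (trans (fix f) (sym aᵢ≡pt))
    ... | refl = trans (⊕-comm e (coordinate (a i))) (cong (coordinate (a i) ⊕_) (sym multiplier-pt))
      where
      multiplier-pt : multiplier f (a i) ≡ e
      multiplier-pt = trans (cong (multiplier f) aᵢ≡pt) (extend-pt e (μf RX f))

  Δ-×Id : ∀ f → Δ RXY ((f ×Id) {Y}) ≡ prodμ (t RXY) (multiplier f ∘ a)
  Δ-×Id f = Δ-telescope RXY ((f ×Id) {Y}) (coordinate ∘ a) (multiplier f ∘ a) (×Id-cocycle f)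

  sum-reps-⊗ : (φ : Carrier X → ℕ) → (∀ g x → φ (act X g x) ≡ φ x) → φ (pt X) ≡ 0 →
               sum (φ ∘ a) ≡ mY * sum (φ ∘ rep RX)
  sum-reps-⊗ φ φ-invariant φ-pt = *-cancelˡ-≡ _ _ n (begin
    n * sum (φ ∘ a)
      ≡⟨ cong (_+ n * sum (φ ∘ a)) φ-pt ⟨
    φ (pt X) + n * sum (φ ∘ a)
      ≡⟨ Z.orbit-sum (φ ∘ proj₁) (λ g z → φ-invariant g (proj₁ z)) ⟨
    sumOver (IX ×-enumeration IY) (φ ∘ proj₁)
      ≡⟨ sumOver-proj₁ IX IY φ ⟩
    mY * sumOver IX φ
      ≡⟨ cong (mY *_) (orbit-sum φ φ-invariant) ⟩
    mY * (φ (pt X) + n * sum (φ ∘ rep RX))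
      ≡⟨ cong (λ x → mY * (x + n * sum (φ ∘ rep RX))) φ-pt ⟩
    mY * (n * sum (φ ∘ rep RX))
      ≡⟨ *-assoc mY n _ ⟨
    mY * n * sum (φ ∘ rep RX)
      ≡⟨ cong (_* sum (φ ∘ rep RX)) (*-comm mY n) ⟩
    n * mY * sum (φ ∘ rep RX)
      ≡⟨ *-assoc n mY _ ⟩
    n * (mY * sum (φ ∘ rep RX))
      ∎)

  sum-multiplier-⊗ : ∀ f → sum (toℕ ∘ multiplier f ∘ a) ≡ mY * sum (toℕ ∘ μf RX f)
  sum-multiplier-⊗ f = trans
    (sum-reps-⊗ (toℕ ∘ multiplier f) (λ g x → cong toℕ (extend-invariant e (μf RX f) g x))
                (cong toℕ (extend-pt e (μf RX f))))
    (cong (mY *_) (sum-cong-≗ (cong toℕ ∘ extend-rep e (μf RX f))))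

  card-Y≡1-mod : mY % n ≡ 1 % n
  card-Y≡1-mod = trans (sym (m%n≡1%n⇒[m*o]%n≡o%n mX mY card≡1-mod)) Z.card≡1-mod

mainTheorem8 : (k : ℕ) (X Y : FreePointedSet k) → IsFinite X → IsFinite Y →
               (f : Aut X) (RX : Reps X) (RXY : Reps (X ⊗ Y)) →
               Δ RXY ((f ×Id) {Y}) ≡ Δ RX f
mainTheorem8 k X Y (mX , IX) (mY , IY) f RX RXY = begin
  Δ RXY ((f ×Id) {Y})
    ≡⟨ Δ-×Id f ⟩
  prodμ (t RXY) (multiplier f ∘ a)
    ≡⟨ prodμ≡sum-mod (t RXY) (multiplier f ∘ a) ⟩
  sum (toℕ ∘ multiplier f ∘ a) mod suc k
    ≡⟨ cong (_mod suc k) (sum-multiplier-⊗ f) ⟩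
  (mY * Σμf) mod suc k
    ≡⟨ mod-cong (mY * Σμf) Σμf (m%n≡1%n⇒[m*o]%n≡o%n mY Σμf card-Y≡1-mod) ⟩
  Σμf mod suc k
    ≡⟨ prodμ≡sum-mod (t RX) (μf RX f) ⟨
  Δ RX f
    ∎
  where
  open ProductOrbits RX RXY IX IY
  open Orbits RX IX using (multiplier)
  Σμf : ℕ
  Σμf = sum (toℕ ∘ μf RX f)
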